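{- For every sufficiently large $s$, there exists a sequence of $s$ job insertions/deletions on a single machine such that the set of active jobs admits a feasible schedule after every request, yet every scheduling algorithm that maintains a feasible schedule after every request incurs total rescheduling (reallocation) cost $\Omega(s^2)$.
   Context: Each job has length $1$, an integer arrival time $a$ and an integer deadline $d>a$. Its window is $[a,d]$, and the job must be placed in a unit timeslot inside its window. A feasible schedule places jobs in distinct timeslots. Requests are job insertions and deletions, processed online. After each request the algorithm outputs a feasible schedule of the active jobs, possibly moving earlier jobs. The reallocation cost of a request is the number of jobs whose scheduled slot changes. The total cost is the sum over all requests. -}

module Defs where

open import Data.Nat using (ℕ; zero; suc; _+_; _*_; _≤_; _<_; _≟_)
open import Data.Product using (_×_; _,_; proj₁; Σ; ∃)
open import Data.List using (List; []; _∷_; map; filter; length; foldl; take; upTo; lookup)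
open import Data.Nat.ListAction using (sum)
open import Data.List.Membership.Propositional using (_∈_; _∉_)
open import Data.List.Membership.DecPropositional _≟_ using (_∈?_)
open import Data.List.Relation.Unary.All using (All)
open import Data.Fin using (Fin; toℕ)
open import Relation.Binary.PropositionalEquality using (_≡_; _≢_)
open import Relation.Nullary using (¬_; ¬?)
open import Relation.Nullary.Decidable using (_×-dec_)

-- A job: a name (identifier), an arrival time a and a deadline d (window [a,d]).
-- Names distinguish jobs with identical windows.
record Job : Set where
  constructor job
  field
    name : ℕ
    arr  : ℕ
    dead : ℕ
open Job public

data Request : Set where
  ins : ℕ → ℕ → ℕ → Request
  del : ℕ → Request

Active : Set
Active = List Job

names : Active → List ℕ
names = map name

apply : Active → Request → Active
apply A (ins i a d) = job i a d ∷ A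
apply A (del i)     = filter (λ j → ¬? (name j ≟ i)) A

ValidReq : Active → Request → Set
ValidReq A (ins i a d) = (a < d) × (i ∉ names A)
ValidReq A (del i)     = i ∈ names A

state : List Request → ℕ → Active
state rs k = foldl apply [] (take k rs)

ValidSeq : List Request → Set
ValidSeq rs = (k : Fin (length rs)) → ValidReq (state rs (toℕ k)) (lookup rs k)

-- A schedule assigns to each job name a unit timeslot [t, t+1] (identified by t).
Schedule : Set
Schedule = ℕ → ℕ

Feasible : Active → Schedule → Set
Feasible A σ =
  All (λ j → (arr j ≤ σ (name j)) × (σ (name j) < dead j)) A ×
  (∀ {j j'} → j ∈ A → j' ∈ A → name j ≢ name j' → σ (name j) ≢ σ (name j'))

AlwaysFeasible : List Request → Set
AlwaysFeasible rs = (k : ℕ) → 1 ≤ k → k ≤ length rs → Σ Schedule (Feasible (state rs k))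

reallocCost : Active → Schedule → Active → Schedule → ℕ
reallocCost A σ A' σ' =
  length (filter (λ j → (name j ∈? names A') ×-dec ¬? (σ (name j) ≟ σ' (name j))) A)

-- Algorithm output: σs k is the schedule output after the k-th request
-- (σs 0 is the schedule of the empty initial state, irrelevant).
-- Total cost = sum over requests k = 1 .. length rs.
totalCost : List Request → (ℕ → Schedule) → ℕ
totalCost rs σs =
  sum (map (λ k → reallocCost (state rs k) (σs k) (state rs (suc k)) (σs (suc k)))
           (upTo (length rs)))

FeasibleRun : List Request → (ℕ → Schedule) → Set
FeasibleRun rs σs = (k : ℕ) → 1 ≤ k → k ≤ length rs → Feasible (state rs k) (σs k)

module Submission where

-- Insert m chain jobs, job i having window [i, i+2] and hence two possible slots. A pin job
-- occupying slot 0 forces every chain job into its later slot, a pin occupying slot m forces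
-- every chain job into its earlier one. Swapping one pin for the other (a deletion followed by
-- an insertion) therefore moves every chain job in one of the two requests, at cost ≥ m.
-- Doing 2n swaps in a sequence of length s = m + 1 + 4n with m, n ≈ s/5 costs Ω(s²).

open import Defs
open import Data.Bool using (true; false)
open import Data.Fin using (Fin; toℕ; zero; suc)
open import Data.Nat using (ℕ; zero; suc; _+_; _*_; _≤_; _<_; _≥_; z≤n; s≤s)
open import Data.Nat.Properties
open import Data.Nat.DivMod using (_/_; _%_; m≡m%n+[m/n]*n; m%n<n; /-monoˡ-≤)
open import Data.Nat.ListAction using (sum)
open import Data.Nat.Tactic.RingSolver using (solve-∀)
open import Data.List using (List; []; _∷_; _++_; _∷ʳ_; length; foldl; take; filter; map; lookup; applyUpTo; downFrom)
open import Data.List.Properties using (length-++; length-map; length-downFrom; foldl-++; foldl-∷ʳ; map-applyUpTo; filter-all)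
open import Data.List.Membership.Propositional using (_∈_; _∉_)
open import Data.List.Membership.Propositional.Properties using (∈-map⁺; ∈-map⁻; ∈-downFrom⁺; ∈-downFrom⁻)
open import Data.List.Membership.DecPropositional _≟_ using (_∈?_)
open import Data.List.Relation.Unary.Any using (here; there)
open import Data.List.Relation.Unary.All as All using (All; _∷_)
import Data.List.Relation.Unary.All.Properties as Allₚ
open import Data.Product using (Σ; ∃; _×_; _,_; proj₁; proj₂)
open import Data.Sum using (_⊎_; inj₁; inj₂)
open import Function using (_∘_)
open import Level using (0ℓ)
open import Relation.Binary.PropositionalEquality
open import Relation.Nullary using (¬?; yes; no; does; contradiction)
open import Relation.Nullary.Decidable using (_×-dec_)
open import Relation.Unary using (Pred; Decidable)

run : Active → List Request → Active
run = foldl apply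

data Admissible : Active → List Request → Set where
  done : ∀ {A} → Admissible A []
  step : ∀ {A r rs} → ValidReq A r → Σ Schedule (Feasible (apply A r)) →
         Admissible (apply A r) rs → Admissible A (r ∷ rs)

step-via : ∀ {A A′ r rs} → apply A r ≡ A′ → ValidReq A r → Σ Schedule (Feasible A′) →
           Admissible A′ rs → Admissible A (r ∷ rs)
step-via refl = step

Admissible-++ : ∀ {A} xs {ys} → Admissible A xs → Admissible (run A xs) ys → Admissible A (xs ++ ys)
Admissible-++ []       done            adm = adm
Admissible-++ (x ∷ xs) (step v f adm) adm′ = step v f (Admissible-++ xs adm adm′)

Admissible⇒valid : ∀ {A} rs → Admissible A rs →
                   (k : Fin (length rs)) → ValidReq (run A (take (toℕ k) rs)) (lookup rs k)
Admissible⇒valid (r ∷ rs) (step v _ _)   zero    = v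
Admissible⇒valid (r ∷ rs) (step _ _ adm) (suc k) = Admissible⇒valid rs adm k

Admissible⇒feasible : ∀ {A} rs → Admissible A rs →
                      ∀ k → 1 ≤ k → k ≤ length rs → Σ Schedule (Feasible (run A (take k rs)))
Admissible⇒feasible (r ∷ rs) (step _ f _)   1             _ _         = f
Admissible⇒feasible (r ∷ rs) (step _ _ adm) (suc (suc k)) _ (s≤s k≤n) =
  Admissible⇒feasible rs adm (suc k) (s≤s z≤n) k≤n

-- σs k is the schedule after the k-th request of rs, so σs 0 schedules A.
cost : Active → List Request → (ℕ → Schedule) → ℕ
cost A []       σs = 0
cost A (r ∷ rs) σs = reallocCost A (σs 0) (apply A r) (σs 1) + cost (apply A r) rs (σs ∘ suc)

shift : ℕ → (ℕ → Schedule) → ℕ → Schedule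
shift n σs k = σs (n + k)

sum-reallocCosts≡cost : ∀ A rs σs →
  sum (applyUpTo (λ k → reallocCost (run A (take k rs)) (σs k) (run A (take (suc k) rs)) (σs (suc k)))
                 (length rs))
  ≡ cost A rs σs
sum-reallocCosts≡cost A []       σs = refl
sum-reallocCosts≡cost A (r ∷ rs) σs = cong (_ +_) (sum-reallocCosts≡cost (apply A r) rs (σs ∘ suc))

totalCost≡cost : ∀ rs σs → totalCost rs σs ≡ cost [] rs σs
totalCost≡cost rs σs = trans (cong sum (map-applyUpTo (λ k → k) _ (length rs))) (sum-reallocCosts≡cost [] rs σs)

cost-++ : ∀ A xs ys σs → cost A (xs ++ ys) σs ≡ cost A xs σs + cost (run A xs) ys (shift (length xs) σs)
cost-++ A []       ys σs = refl
cost-++ A (x ∷ xs) ys σs =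
  trans (cong (reallocCost A (σs 0) (apply A x) (σs 1) +_) (cost-++ (apply A x) xs ys (σs ∘ suc)))
        (sym (+-assoc (reallocCost A (σs 0) (apply A x) (σs 1)) _ _))

cost-∷ : ∀ {A A′ r} rs σs → apply A r ≡ A′ →
         cost A (r ∷ rs) σs ≡ reallocCost A (σs 0) A′ (σs 1) + cost A′ rs (σs ∘ suc)
cost-∷ rs σs refl = refl

FeasibleFrom : Active → List Request → (ℕ → Schedule) → Set
FeasibleFrom A rs σs = ∀ k → k ≤ length rs → Feasible (run A (take k rs)) (σs k)

FeasibleFrom-head : ∀ {A rs σs} → FeasibleFrom A rs σs → Feasible A (σs 0)
FeasibleFrom-head feas = feas 0 z≤n

FeasibleFrom-∷ : ∀ {A A′ r rs σs} → apply A r ≡ A′ → FeasibleFrom A (r ∷ rs) σs → FeasibleFrom A′ rs (σs ∘ suc)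
FeasibleFrom-∷ refl feas k k≤n = feas (suc k) (s≤s k≤n)

take-length-++ : ∀ {X : Set} (xs : List X) {ys} k → take (length xs + k) (xs ++ ys) ≡ xs ++ take k ys
take-length-++ []       k = refl
take-length-++ (x ∷ xs) k = cong (x ∷_) (take-length-++ xs k)

FeasibleRun⇒FeasibleFrom : ∀ xs ys σs → 1 ≤ length xs → FeasibleRun (xs ++ ys) σs →
                           FeasibleFrom (run [] xs) ys (shift (length xs) σs)
FeasibleRun⇒FeasibleFrom xs ys σs nonempty feas k k≤n =
  subst (λ A → Feasible A (σs (length xs + k)))
        (trans (cong (run []) (take-length-++ xs k)) (foldl-++ apply [] xs (take k ys)))
        (feas (length xs + k) (≤-trans nonempty (m≤m+n _ k))
              (≤-trans (+-monoʳ-≤ (length xs) k≤n) (≤-reflexive (sym (length-++ xs)))))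

module _ {X : Set} {P Q : Pred X 0ℓ} (P? : Decidable P) (Q? : Decidable Q) where

  length≤filter+filter : ∀ xs → (∀ {x} → x ∈ xs → P x ⊎ Q x) →
                         length xs ≤ length (filter P? xs) + length (filter Q? xs)
  length≤filter+filter []       cover = z≤n
  length≤filter+filter (x ∷ xs) cover
    with P? x | Q? x | cover (here refl) | length≤filter+filter xs (cover ∘ there)
  ... | yes _ | yes _ | _      | ih = s≤s (≤-trans ih (+-monoʳ-≤ _ (n≤1+n _)))
  ... | yes _ | no _  | _      | ih = s≤s ih
  ... | no _  | yes _ | _      | ih = ≤-trans (s≤s ih) (≤-reflexive (sym (+-suc _ _)))
  ... | no ¬p | no _  | inj₁ p | _  = contradiction p ¬p
  ... | no _  | no ¬q | inj₂ q | _  = contradiction q ¬q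

length-filter-∷ : ∀ {X : Set} {P : Pred X 0ℓ} (P? : Decidable P) x xs →
                  length (filter P? xs) ≤ length (filter P? (x ∷ xs))
length-filter-∷ P? x xs with does (P? x)
... | true  = n≤1+n _
... | false = ≤-refl

reallocCost-detour : ∀ z z′ B σ τ ρ → (∀ {j} → j ∈ B → σ (name j) ≢ ρ (name j)) →
                     length B ≤ reallocCost (z ∷ B) σ B τ + reallocCost B τ (z′ ∷ B) ρ
reallocCost-detour z z′ B σ τ ρ moved =
  ≤-trans (length≤filter+filter movedFirst? movedSecond? B cover)
          (+-monoˡ-≤ _ (length-filter-∷ movedFirst? z B))
  where
  movedFirst? : Decidable (λ j → (name j ∈ names B) × σ (name j) ≢ τ (name j))
  movedFirst?  = λ j → (name j ∈? names B) ×-dec ¬? (σ (name j) ≟ τ (name j))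
  movedSecond? : Decidable (λ j → (name j ∈ names (z′ ∷ B)) × τ (name j) ≢ ρ (name j))
  movedSecond? = λ j → (name j ∈? names (z′ ∷ B)) ×-dec ¬? (τ (name j) ≟ ρ (name j))
  cover : ∀ {j} → j ∈ B → ((name j ∈ names B) × σ (name j) ≢ τ (name j))
                          ⊎ ((name j ∈ names (z′ ∷ B)) × τ (name j) ≢ ρ (name j))
  cover {j} j∈B with σ (name j) ≟ τ (name j)
  ... | no  σ≢τ = inj₁ (∈-map⁺ name j∈B , σ≢τ)
  ... | yes σ≡τ = inj₂ (there (∈-map⁺ name j∈B) , λ τ≡ρ → moved j∈B (trans σ≡τ τ≡ρ))

-- Chain jobs are named from 1, leaving the name 0 to the pins.
link : ℕ → Job
link i = job (suc i) i (suc (suc i))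

chain : ℕ → Active
chain m = map link (downFrom m)

pinFirst : Job
pinFirst = job 0 0 1

pinLast : ℕ → Job
pinLast m = job 0 m (suc m)

∈-chain⁻ : ∀ {m j} → j ∈ chain m → ∃ λ i → i < m × j ≡ link i
∈-chain⁻ j∈ with i , i∈ , refl ← ∈-map⁻ link j∈ = i , ∈-downFrom⁻ i∈ , refl

link∈chain : ∀ {m i} → i < m → link i ∈ chain m
link∈chain i<m = ∈-map⁺ link (∈-downFrom⁺ i<m)

∈-names-chain⁻ : ∀ {m k} → k ∈ names (chain m) → ∃ λ i → i < m × k ≡ suc i
∈-names-chain⁻ k∈ with j , j∈ , refl ← ∈-map⁻ name k∈ with i , i<m , refl ← ∈-chain⁻ j∈ = i , i<m , refl

0∉names-chain : ∀ m → 0 ∉ names (chain m)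
0∉names-chain m 0∈ with _ , _ , () ← ∈-names-chain⁻ 0∈

1+m∉names-chain : ∀ m → suc m ∉ names (chain m)
1+m∉names-chain m m+1∈ with i , i<m , refl ← ∈-names-chain⁻ m+1∈ = <-irrefl refl i<m

length-chain : ∀ m → length (chain m) ≡ m
length-chain m = trans (length-map link (downFrom m)) (length-downFrom m)

apply-chain-del-0 : ∀ m → apply (chain m) (del 0) ≡ chain m
apply-chain-del-0 m = filter-all (λ j → ¬? (name j ≟ 0)) (All.tabulate λ j∈ → name≢0 (∈-chain⁻ j∈))
  where
  name≢0 : ∀ {j} → ∃ (λ i → i < m × j ≡ link i) → name j ≢ 0
  name≢0 (_ , _ , refl) ()

Feasible-byName : ∀ {A} → All (λ j → arr j ≤ name j × name j < dead j) A → Feasible A (λ t → t)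
Feasible-byName inWindows = inWindows , λ _ _ names≢ → names≢

chain-byName : ∀ m → All (λ j → arr j ≤ name j × name j < dead j) (chain m)
chain-byName m = Allₚ.map⁺ (All.universal (λ i → n≤1+n i , ≤-refl) (downFrom m))

Feasible-pinFirst : ∀ m → Feasible (pinFirst ∷ chain m) (λ t → t)
Feasible-pinFirst m = Feasible-byName ((z≤n , s≤s z≤n) ∷ chain-byName m)

slotsLeft : ℕ → Schedule
slotsLeft m zero    = m
slotsLeft m (suc i) = i

Feasible-pinLast : ∀ m → Feasible (pinLast m ∷ chain m) (slotsLeft m)
Feasible-pinLast m =
  ((≤-refl , ≤-refl) ∷ Allₚ.map⁺ (All.universal (λ i → ≤-refl , m≤n⇒m≤1+n ≤-refl) (downFrom m))) ,
  distinct
  where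
  distinct : ∀ {j j′} → j ∈ pinLast m ∷ chain m → j′ ∈ pinLast m ∷ chain m →
             name j ≢ name j′ → slotsLeft m (name j) ≢ slotsLeft m (name j′)
  distinct (here refl) (here refl) names≢ = contradiction refl names≢
  distinct (here refl) (there j′∈) _ with _ , i<m , refl ← ∈-chain⁻ j′∈ = <⇒≢ i<m ∘ sym
  distinct (there j∈) (here refl) _ with _ , i<m , refl ← ∈-chain⁻ j∈ = <⇒≢ i<m
  distinct (there j∈) (there j′∈) names≢ with _ , _ , refl ← ∈-chain⁻ j∈ | _ , _ , refl ← ∈-chain⁻ j′∈ =
    names≢ ∘ cong suc

module _ {A σ} (feasible : Feasible A σ) where

  slot-in-window : ∀ {j} → j ∈ A → arr j ≤ σ (name j) × σ (name j) < dead j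
  slot-in-window = All.lookup (proj₁ feasible)

  link-pushed-right : ∀ {i j} → link i ∈ A → j ∈ A → name j ≢ suc i → σ (name j) ≡ i → σ (suc i) ≡ suc i
  link-pushed-right link∈ j∈ names≢ j-at-i with above , below ← slot-in-window link∈ =
    ≤-antisym (≤-pred below) (≤∧≢⇒< above (λ i≡ → proj₂ feasible j∈ link∈ names≢ (trans j-at-i i≡)))

  link-pushed-left : ∀ {i j} → link i ∈ A → j ∈ A → name j ≢ suc i → σ (name j) ≡ suc i → σ (suc i) ≡ i
  link-pushed-left link∈ j∈ names≢ j-at-1+i with above , below ← slot-in-window link∈ =
    ≤-antisym (≤-pred (≤∧≢⇒< (≤-pred below) (λ ≡1+i → proj₂ feasible j∈ link∈ names≢ (trans j-at-1+i (sym ≡1+i)))))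
              above

  unit-window : ∀ {j} → j ∈ A → dead j ≡ suc (arr j) → σ (name j) ≡ arr j
  unit-window j∈ refl = ≤-antisym (≤-pred (proj₂ (slot-in-window j∈))) (proj₁ (slot-in-window j∈))

shifted-right : ∀ {m σ} → Feasible (pinFirst ∷ chain m) σ → ∀ {i} → i < m → σ (suc i) ≡ suc i
shifted-right feasible {zero} 0<m =
  link-pushed-right feasible (there (link∈chain 0<m)) (here refl) (λ ()) (unit-window feasible (here refl) refl)
shifted-right feasible {suc i} i+1<m =
  link-pushed-right feasible (there (link∈chain i+1<m)) (there (link∈chain (<⇒≤ i+1<m))) (1+n≢n ∘ sym)
                    (shifted-right feasible (<⇒≤ i+1<m))

shifted-left : ∀ {m σ} → Feasible (pinLast m ∷ chain m) σ → ∀ {i} → i < m → σ (suc i) ≡ i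
shifted-left {m} {σ} feasible i<m with d , i+1+d≡m ← m≤n⇒∃[o]m+o≡n i<m = fromTop d i+1+d≡m
  where
  fromTop : ∀ d {i} → suc i + d ≡ m → σ (suc i) ≡ i
  fromTop zero {i} i+1≡m =
    link-pushed-left feasible (there (link∈chain (≤-reflexive i+1≡m′))) (here refl) (λ ())
                     (trans (unit-window feasible (here refl) refl) (sym i+1≡m′))
    where
    i+1≡m′ : suc i ≡ m
    i+1≡m′ = trans (sym (+-identityʳ (suc i))) i+1≡m
  fromTop (suc d) {i} i+1+d+1≡m =
    link-pushed-left feasible (there (link∈chain (subst (suc i ≤_) i+1+d+1≡m (m≤m+n (suc i) (suc d)))))
                     (there (link∈chain (subst (suc (suc i) ≤_) i+2+d≡m (m≤m+n (suc (suc i)) d))))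
                     1+n≢n (fromTop d i+2+d≡m)
    where
    i+2+d≡m : suc (suc i) + d ≡ m
    i+2+d≡m = trans (sym (+-suc (suc i) d)) i+1+d+1≡m

chain-swapped : ∀ {m σ τ} → Feasible (pinFirst ∷ chain m) σ → Feasible (pinLast m ∷ chain m) τ →
                ∀ {j} → j ∈ chain m → σ (name j) ≢ τ (name j)
chain-swapped right left j∈ with i , i<m , refl ← ∈-chain⁻ j∈ =
  λ eq → 1+n≢n (trans (sym (shifted-right right i<m)) (trans eq (shifted-left left i<m)))

insert : Job → Request
insert j = ins (name j) (arr j) (dead j)

swing : ℕ → ℕ → List Request
swing m zero    = []
swing m (suc n) = del 0 ∷ insert (pinLast m) ∷ del 0 ∷ insert pinFirst ∷ swing m n

cost-detour : ∀ {m a d a′ d′} rs σs → (∀ {j} → j ∈ chain m → σs 0 (name j) ≢ σs 2 (name j)) →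
              m + cost (job 0 a′ d′ ∷ chain m) rs (shift 2 σs)
                ≤ cost (job 0 a d ∷ chain m) (del 0 ∷ ins 0 a′ d′ ∷ rs) σs
cost-detour {m} {a} {d} {a′} {d′} rs σs moved = begin
  m + rest                                  ≡⟨ cong (_+ rest) (sym (length-chain m)) ⟩
  length (chain m) + rest                   ≤⟨ +-monoˡ-≤ rest (reallocCost-detour (job 0 a d) (job 0 a′ d′) (chain m) (σs 0) (σs 1) (σs 2) moved) ⟩
  (realloc₀ + realloc₁) + rest              ≡⟨ +-assoc realloc₀ realloc₁ rest ⟩
  realloc₀ + (realloc₁ + rest)              ≡⟨ cost-∷ {A = job 0 a d ∷ chain m} {r = del 0} (ins 0 a′ d′ ∷ rs) σs (apply-chain-del-0 m) ⟨
  cost (job 0 a d ∷ chain m) (del 0 ∷ ins 0 a′ d′ ∷ rs) σs ∎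
  where
  open ≤-Reasoning
  rest realloc₀ realloc₁ : ℕ
  rest     = cost (job 0 a′ d′ ∷ chain m) rs (shift 2 σs)
  realloc₀ = reallocCost (job 0 a d ∷ chain m) (σs 0) (chain m) (σs 1)
  realloc₁ = reallocCost (chain m) (σs 1) (job 0 a′ d′ ∷ chain m) (σs 2)

swing-cost : ∀ m n σs → FeasibleFrom (pinFirst ∷ chain m) (swing m n) σs →
             n * (m + m) ≤ cost (pinFirst ∷ chain m) (swing m n) σs
swing-cost m zero    σs _        = z≤n
swing-cost m (suc n) σs feasible = begin
  (m + m) + n * (m + m)                                       ≡⟨ +-assoc m m (n * (m + m)) ⟩
  m + (m + n * (m + m))                                       ≤⟨ +-monoʳ-≤ m (+-monoʳ-≤ m (swing-cost m n σs⁴ feasible⁴)) ⟩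
  m + (m + cost (pinFirst ∷ chain m) (swing m n) σs⁴)         ≤⟨ +-monoʳ-≤ m (cost-detour (swing m n) σs² toRight) ⟩
  m + cost (pinLast m ∷ chain m) (del 0 ∷ insert pinFirst ∷ swing m n) σs² ≤⟨ cost-detour (del 0 ∷ insert pinFirst ∷ swing m n) σs toLeft ⟩
  cost (pinFirst ∷ chain m) (swing m (suc n)) σs              ∎
  where
  open ≤-Reasoning
  σs² σs⁴ : ℕ → Schedule
  σs² = shift 2 σs
  σs⁴ = shift 4 σs
  feasible² : FeasibleFrom (pinLast m ∷ chain m) (del 0 ∷ insert pinFirst ∷ swing m n) σs²
  feasible² = FeasibleFrom-∷ refl (FeasibleFrom-∷ (apply-chain-del-0 m) feasible)
  feasible⁴ : FeasibleFrom (pinFirst ∷ chain m) (swing m n) σs⁴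
  feasible⁴ = FeasibleFrom-∷ refl (FeasibleFrom-∷ (apply-chain-del-0 m) feasible²)
  toLeft : ∀ {j} → j ∈ chain m → σs 0 (name j) ≢ σs 2 (name j)
  toLeft = chain-swapped (FeasibleFrom-head feasible) (FeasibleFrom-head feasible²)
  toRight : ∀ {j} → j ∈ chain m → σs 2 (name j) ≢ σs 4 (name j)
  toRight j∈ = ≢-sym (chain-swapped (FeasibleFrom-head feasible⁴) (FeasibleFrom-head feasible²) j∈)

build : ℕ → List Request
build zero    = []
build (suc m) = build m ∷ʳ insert (link m)

setup : ℕ → List Request
setup m = build m ∷ʳ insert pinFirst

adversary : ℕ → ℕ → List Request
adversary m n = setup m ++ swing m n

run-build : ∀ m → run [] (build m) ≡ chain m
run-build zero    = refl
run-build (suc m) = trans (foldl-∷ʳ apply [] (insert (link m)) (build m)) (cong (link m ∷_) (run-build m))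

run-setup : ∀ m → run [] (setup m) ≡ pinFirst ∷ chain m
run-setup m = trans (foldl-∷ʳ apply [] (insert pinFirst) (build m)) (cong (pinFirst ∷_) (run-build m))

length-∷ʳ : ∀ {X : Set} (xs : List X) x → length (xs ∷ʳ x) ≡ suc (length xs)
length-∷ʳ xs x = trans (length-++ xs) (+-comm (length xs) 1)

length-build : ∀ m → length (build m) ≡ m
length-build zero    = refl
length-build (suc m) = trans (length-∷ʳ (build m) (insert (link m))) (cong suc (length-build m))

length-setup : ∀ m → length (setup m) ≡ suc m
length-setup m = trans (length-∷ʳ (build m) (insert pinFirst)) (cong suc (length-build m))

length-swing : ∀ m n → length (swing m n) ≡ n * 4
length-swing m zero    = refl
length-swing m (suc n) = cong (4 +_) (length-swing m n)

length-adversary : ∀ m n → length (adversary m n) ≡ suc (m + n * 4)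
length-adversary m n = trans (length-++ (setup m)) (cong₂ _+_ (length-setup m) (length-swing m n))

Admissible-∷ʳ : ∀ {A B} xs {r} → Admissible A xs → run A xs ≡ B → ValidReq B r →
                Σ Schedule (Feasible (apply B r)) → Admissible A (xs ∷ʳ r)
Admissible-∷ʳ xs adm refl valid feasible = Admissible-++ xs adm (step valid feasible done)

Admissible-build : ∀ m → Admissible [] (build m)
Admissible-build zero    = done
Admissible-build (suc m) =
  Admissible-∷ʳ (build m) (Admissible-build m) (run-build m)
    (m≤n⇒m≤1+n ≤-refl , 1+m∉names-chain m) (_ , Feasible-byName (chain-byName (suc m)))

Admissible-swing : ∀ m n → Admissible (pinFirst ∷ chain m) (swing m n)
Admissible-swing m zero    = done
Admissible-swing m (suc n) =
  step-via (apply-chain-del-0 m) (here refl) (_ , Feasible-byName (chain-byName m))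
    (step (≤-refl , 0∉names-chain m) (_ , Feasible-pinLast m)
      (step-via (apply-chain-del-0 m) (here refl) (_ , Feasible-byName (chain-byName m))
        (step (s≤s z≤n , 0∉names-chain m) (_ , Feasible-pinFirst m) (Admissible-swing m n))))

Admissible-adversary : ∀ m n → Admissible [] (adversary m n)
Admissible-adversary m n =
  Admissible-++ (setup m)
    (Admissible-∷ʳ (build m) (Admissible-build m) (run-build m) (s≤s z≤n , 0∉names-chain m) (_ , Feasible-pinFirst m))
    (subst (λ A → Admissible A (swing m n)) (sym (run-setup m)) (Admissible-swing m n))

adversary-cost : ∀ m n σs → FeasibleRun (adversary m n) σs → n * (m + m) ≤ totalCost (adversary m n) σs
adversary-cost m n σs feasible = begin
  n * (m + m)                                                       ≤⟨ swing-cost m n σs′ feasible′ ⟩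
  cost (pinFirst ∷ chain m) (swing m n) σs′                         ≡⟨ cong (λ A → cost A (swing m n) σs′) (run-setup m) ⟨
  cost (run [] (setup m)) (swing m n) σs′                           ≤⟨ m≤n+m _ _ ⟩
  cost [] (setup m) σs + cost (run [] (setup m)) (swing m n) σs′    ≡⟨ cost-++ [] (setup m) (swing m n) σs ⟨
  cost [] (adversary m n) σs                                        ≡⟨ totalCost≡cost (adversary m n) σs ⟨
  totalCost (adversary m n) σs                                      ∎
  where
  open ≤-Reasoning
  σs′ : ℕ → Schedule
  σs′ = shift (length (setup m)) σs
  feasible′ : FeasibleFrom (pinFirst ∷ chain m) (swing m n) σs′
  feasible′ = subst (λ A → FeasibleFrom A (swing m n) σs′) (run-setup m)
                (FeasibleRun⇒FeasibleFrom (setup m) (swing m n) σs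
                  (subst (1 ≤_) (sym (length-setup m)) (s≤s z≤n)) feasible)

square-bound : ∀ s n t → s ≤ n * 6 → n * (n + n) ≤ t → s * s ≤ 18 * t
square-bound s n t s≤6n cost≥ = begin
  s * s                ≤⟨ *-mono-≤ s≤6n s≤6n ⟩
  (n * 6) * (n * 6)    ≡⟨ expand n ⟩
  18 * (n * (n + n))   ≤⟨ *-monoʳ-≤ 18 cost≥ ⟩
  18 * t               ∎
  where
  open ≤-Reasoning
  expand : ∀ n → (n * 6) * (n * 6) ≡ 18 * (n * (n + n))
  expand = solve-∀

1+k≤[k/5]*6 : ∀ k → 25 ≤ k → suc k ≤ (k / 5) * 6
1+k≤[k/5]*6 k 25≤k = begin
  suc k                           ≡⟨ cong suc (m≡m%n+[m/n]*n k 5) ⟩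
  suc (k % 5) + (k / 5) * 5       ≤⟨ +-monoˡ-≤ ((k / 5) * 5) (m%n<n k 5) ⟩
  5 + (k / 5) * 5                 ≤⟨ +-monoˡ-≤ ((k / 5) * 5) (/-monoˡ-≤ 5 25≤k) ⟩
  k / 5 + (k / 5) * 5             ≡⟨ *-suc (k / 5) 5 ⟨
  (k / 5) * 6                     ∎
  where open ≤-Reasoning

lemma8 : Σ ℕ λ c → Σ ℕ λ s₀ → (s : ℕ) → s ≥ s₀ →
           Σ (List Request) λ rs →
             (length rs ≡ s) × ValidSeq rs × AlwaysFeasible rs ×
             ((σs : ℕ → Schedule) → FeasibleRun rs σs → s * s ≤ c * totalCost rs σs)
lemma8 = 18 , 26 , λ where
  (suc k) (s≤s 25≤k) → let n = k / 5 ; m = k % 5 + n in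
    adversary m n ,
    trans (length-adversary m n)
          (cong suc (trans (+-assoc (k % 5) n (n * 4))
                           (trans (cong (k % 5 +_) (sym (*-suc n 4))) (sym (m≡m%n+[m/n]*n k 5))))) ,
    Admissible⇒valid (adversary m n) (Admissible-adversary m n) ,
    Admissible⇒feasible (adversary m n) (Admissible-adversary m n) ,
    λ σs feasible → square-bound (suc k) n _ (1+k≤[k/5]*6 k 25≤k)
      (≤-trans (*-monoʳ-≤ n (+-mono-≤ (m≤n+m n (k % 5)) (m≤n+m n (k % 5)))) (adversary-cost m n σs feasible))
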